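{- For all $(x_1,x_2)\in\mathbb{N}^2$, we have $x_2=\operatorname{HW}(x_1)$ if and only if there exists $(y_1,\dots,y_{12})\in\mathbb{N}^{12}$ such that \[ B(2x_1,x_1,y_2,y_3,\dots,y_8,y_1)+E_\nu(y_1,y_9,y_{10},y_{11},y_{12},x_2)=0 . \]
   Context: $\mathbb{N}$ includes $0$; $\operatorname{HW}(m)$ is the number of $1$'s in the binary representation of $m$. For integers $a,b,c,d,e$ define $E_/(a,b,c,d,e)=(a-be-c)^2+(c+d+1-b)^2$ and $E_{\bmod}(a,b,c,d,e)=(a-bc-e)^2+(e+d+1-b)^2$. For integers $a,b,z_1,\dots,z_7,c$ define \[ B(a,b,z_1,\dots,z_7,c)=\big(z_1-(2a^3+8a^2+2ab+12a+4b+8)\big)^2+\big(z_2-(2a^2+8a+8)\big)^2+E_/\big(2^{z_1},2^{z_2}-2^{2a+4}-1,z_4,z_5,z_3\big)+E_{\bmod}\big(z_3,2^{2a+4},z_6,z_7,c\big). \] For integers $a,z_1,z_2,z_3,z_4,e$ with $e\ge 0$ define \[ E_\nu(a,z_1,z_2,z_3,z_4,e)=(a-2^{e+1}z_1-z_2-1)^2+(z_2+z_3+2-2^{e+1})^2+(a-2^{e}z_4)^2 . \] -}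

module Defs where

open import Data.Nat as ℕ using (ℕ; zero; suc)
open import Data.Nat.DivMod using (_/_; _%_)
open import Data.Integer using (ℤ; +_; _+_; _-_; _*_)

-- Hamming weight (number of 1's in the binary representation).
-- hwAux f n reads off f binary digits of n; f = n digits always suffice.
hwAux : ℕ → ℕ → ℕ
hwAux zero    n = 0
hwAux (suc f) n = n % 2 ℕ.+ hwAux f (n / 2)

HW : ℕ → ℕ
HW n = hwAux n n

sq : ℤ → ℤ
sq x = x * x

pow2 : ℕ → ℤ
pow2 k = + (2 ℕ.^ k)

E/ : ℤ → ℤ → ℤ → ℤ → ℤ → ℤ
E/ a b c d e = sq (a - b * e - c) + sq (c + d + + 1 - b)

Emod : ℤ → ℤ → ℤ → ℤ → ℤ → ℤ
Emod a b c d e = sq (a - b * c - e) + sq (e + d + + 1 - b)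

-- B with all arguments natural (exponents 2^{z1}, 2^{z2}, 2^{2a+4} require naturals)
B : ℕ → ℕ → ℕ → ℕ → ℕ → ℕ → ℕ → ℕ → ℕ → ℕ → ℤ
B a b z1 z2 z3 z4 z5 z6 z7 c =
  let A = + a ; Bz = + b in
    sq (+ z1 - (+ 2 * A * A * A + + 8 * A * A + + 2 * A * Bz + + 12 * A + + 4 * Bz + + 8))
  + sq (+ z2 - (+ 2 * A * A + + 8 * A + + 8))
  + E/ (pow2 z1) (pow2 z2 - pow2 (2 ℕ.* a ℕ.+ 4) - + 1) (+ z4) (+ z5) (+ z3)
  + Emod (+ z3) (pow2 (2 ℕ.* a ℕ.+ 4)) (+ z6) (+ z7) (+ c)

Eν : ℕ → ℕ → ℕ → ℕ → ℕ → ℕ → ℤ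
Eν a z1 z2 z3 z4 e =
    sq (+ a - pow2 (suc e) * + z1 - + z2 - + 1)
  + sq (+ z2 + + z3 + + 2 - pow2 (suc e))
  + sq (+ a - pow2 e * + z4)

{-# OPTIONS --safe #-}
-- By Legendre's formula ν₂(n!) = n − HW(n), and since HW(2x) = HW(x), the central binomial
-- coefficient C(2x, x) = (2x)!/(x!)² has 2-adic valuation HW(x).  So it suffices that
-- B(a, b, z, c) = 0 is solvable exactly when c = C(a, b), and Eν(y, w, e) = 0 exactly when
-- ν₂(y) = e; a sum of squares vanishes iff every square does.
-- For B: with u = 2^(2a+4), U = u^(a+2) and d = U − u − 1 we have U ≡ 1 + u (mod d), so
-- 2^z₁ = U^a·u^(b+2) ≡ (1 + u)^a·u^(b+2).  The base-u digits of (1 + u)^a are the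
-- C(a, k) ≤ 2^a, far below u; hence the remainder of 2^z₁ modulo d can be written down
-- exactly, and the quotient ⌊2^z₁/d⌋ has C(a, b) as its last base-u digit.
module Submission where

module TwoAdicValuation where

  open import Data.Nat
  open import Data.Nat.Properties
  open import Data.Nat.DivMod using (_/_; _%_; m*n%n≡0; [m+kn]%n≡m%n; m*n/n≡m; +-distrib-/-∣ʳ; m/n<m; m/n*n≡m)
  open import Data.Nat.Divisibility using (divides)
  open import Data.Nat.Induction using (<-rec)
  open import Data.Nat.Combinatorics using (_C_; nCk≡n!/k![n-k]!; k![n∸k]!∣n!)
  open import Data.Nat.Tactic.RingSolver using (solve-∀)
  open import Data.Product using (∃-syntax; _,_)
  open import Relation.Binary.PropositionalEquality
  open import Relation.Nullary using (contradiction)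
  open import Defs using (hwAux; HW)

  data EvenOdd : ℕ → Set where
    even : ∀ m → EvenOdd (2 * m)
    odd  : ∀ m → EvenOdd (1 + 2 * m)

  evenOdd : ∀ n → EvenOdd n
  evenOdd zero = even 0
  evenOdd (suc n) with evenOdd n
  ... | even m = odd m
  ... | odd m  = subst EvenOdd (*-suc 2 m) (even (suc m))

  binary-induction : (P : ℕ → Set) → P 0 →
                     (∀ m → P m → P (2 * m)) → (∀ m → P m → P (1 + 2 * m)) →
                     ∀ n → P n
  binary-induction P P0 P2* P1+2* = <-rec P step
    where
    step : ∀ n → (∀ {m} → m < n → P m) → P n
    step n rec with evenOdd n
    ... | even zero    = P0
    ... | even (suc m) = P2* (suc m) (rec (m<m+n (suc m) z<s))
    ... | odd m        = P1+2* m (rec (s≤s (m≤n*m m 2)))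

  infix 4 ν₂[_]≡_

  record ν₂[_]≡_ (n e : ℕ) : Set where
    constructor mkν₂
    field
      oddPart : ℕ
      n≡2^e*odd : n ≡ 2 ^ e * (1 + 2 * oddPart)

  ν₂[2^e]≡e : ∀ e → ν₂[ 2 ^ e ]≡ e
  ν₂[2^e]≡e e = mkν₂ 0 (sym (*-identityʳ (2 ^ e)))

  ν₂[1+2k]≡0 : ∀ k → ν₂[ 1 + 2 * k ]≡ 0
  ν₂[1+2k]≡0 k = mkν₂ k (sym (+-identityʳ (1 + 2 * k)))

  ν₂-* : ∀ {m n e f} → ν₂[ m ]≡ e → ν₂[ n ]≡ f → ν₂[ m * n ]≡ e + f
  ν₂-* {e = e} {f} (mkν₂ k refl) (mkν₂ l refl) = mkν₂ (k + l + 2 * k * l) (begin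
    2 ^ e * (1 + 2 * k) * (2 ^ f * (1 + 2 * l))     ≡⟨ regroup (2 ^ e) (2 ^ f) k l ⟩
    2 ^ e * 2 ^ f * (1 + 2 * (k + l + 2 * k * l))   ≡⟨ cong (_* _) (^-distribˡ-+-* 2 e f) ⟨
    2 ^ (e + f) * (1 + 2 * (k + l + 2 * k * l))     ∎)
    where
    open ≡-Reasoning
    regroup : ∀ p q k l → p * (1 + 2 * k) * (q * (1 + 2 * l)) ≡ p * q * (1 + 2 * (k + l + 2 * k * l))
    regroup = solve-∀

  [2m]%2≡0 : ∀ m → 2 * m % 2 ≡ 0
  [2m]%2≡0 m = trans (cong (_% 2) (*-comm 2 m)) (m*n%n≡0 m 2)

  [1+2m]%2≡1 : ∀ m → (1 + 2 * m) % 2 ≡ 1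
  [1+2m]%2≡1 m = trans (cong (λ n → (1 + n) % 2) (*-comm 2 m)) ([m+kn]%n≡m%n 1 m 2)

  [2m]/2≡m : ∀ m → 2 * m / 2 ≡ m
  [2m]/2≡m m = trans (cong (_/ 2) (*-comm 2 m)) (m*n/n≡m m 2)

  [1+2m]/2≡m : ∀ m → (1 + 2 * m) / 2 ≡ m
  [1+2m]/2≡m m = trans (+-distrib-/-∣ʳ 1 (divides m (*-comm 2 m))) ([2m]/2≡m m)

  1+2k≢2m : ∀ k m → 1 + 2 * k ≢ 2 * m
  1+2k≢2m k m eq = 1+n≢0 (trans (sym ([1+2m]%2≡1 k)) (trans (cong (_% 2) eq) ([2m]%2≡0 m)))

  2^e*odd-injective : ∀ e f k l → 2 ^ e * (1 + 2 * k) ≡ 2 ^ f * (1 + 2 * l) → e ≡ f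
  2^e*odd-injective zero    zero    k l eq = refl
  2^e*odd-injective zero    (suc f) k l eq = contradiction
    (trans (sym (*-identityˡ (1 + 2 * k))) (trans eq (*-assoc 2 (2 ^ f) (1 + 2 * l))))
    (1+2k≢2m k (2 ^ f * (1 + 2 * l)))
  2^e*odd-injective (suc e) zero    k l eq = contradiction
    (trans (sym (*-identityˡ (1 + 2 * l))) (trans (sym eq) (*-assoc 2 (2 ^ e) (1 + 2 * k))))
    (1+2k≢2m l (2 ^ e * (1 + 2 * k)))
  2^e*odd-injective (suc e) (suc f) k l eq = cong suc (2^e*odd-injective e f k l (*-cancelˡ-≡ _ _ 2 (begin
    2 * (2 ^ e * (1 + 2 * k))   ≡⟨ *-assoc 2 (2 ^ e) (1 + 2 * k) ⟨
    2 ^ suc e * (1 + 2 * k)     ≡⟨ eq ⟩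
    2 ^ suc f * (1 + 2 * l)     ≡⟨ *-assoc 2 (2 ^ f) (1 + 2 * l) ⟩
    2 * (2 ^ f * (1 + 2 * l))   ∎)))
    where open ≡-Reasoning

  ν₂-unique : ∀ {n e f} → ν₂[ n ]≡ e → ν₂[ n ]≡ f → e ≡ f
  ν₂-unique {e = e} {f} (mkν₂ k p) (mkν₂ l q) = 2^e*odd-injective e f k l (trans (sym p) q)

  ν₂-exists : ∀ n → n ≢ 0 → ∃[ e ] ν₂[ n ]≡ e
  ν₂-exists = binary-induction (λ n → n ≢ 0 → ∃[ e ] ν₂[ n ]≡ e)
    (λ 0≢0 → contradiction refl 0≢0) double (λ m _ _ → 0 , ν₂[1+2k]≡0 m)
    where
    double : ∀ m → (m ≢ 0 → ∃[ e ] ν₂[ m ]≡ e) → 2 * m ≢ 0 → ∃[ e ] ν₂[ 2 * m ]≡ e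
    double m ih 2m≢0 with ih (λ m≡0 → 2m≢0 (cong (2 *_) m≡0))
    ... | e , ν = suc e , ν₂-* (ν₂[2^e]≡e 1) ν

  hwAux-zero : ∀ f → hwAux f 0 ≡ 0
  hwAux-zero zero    = refl
  hwAux-zero (suc f) = hwAux-zero f

  n≤1+f⇒n/2≤f : ∀ {n f} → n ≤ suc f → n / 2 ≤ f
  n≤1+f⇒n/2≤f {zero}  _   = z≤n
  n≤1+f⇒n/2≤f {suc n} n≤f = s≤s⁻¹ (≤-trans (m/n<m (suc n) 2 (s≤s (s≤s z≤n))) n≤f)

  hwAux-stable : ∀ {f g n} → n ≤ f → n ≤ g → hwAux f n ≡ hwAux g n
  hwAux-stable {zero}  {g}     z≤n _   = sym (hwAux-zero g)
  hwAux-stable {suc f} {zero}  _   z≤n = hwAux-zero (suc f)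
  hwAux-stable {suc f} {suc g} {n} n≤f n≤g =
    cong (n % 2 +_) (hwAux-stable (n≤1+f⇒n/2≤f n≤f) (n≤1+f⇒n/2≤f n≤g))

  HW≡n%2+HW[n/2] : ∀ n → HW n ≡ n % 2 + HW (n / 2)
  HW≡n%2+HW[n/2] zero        = refl
  HW≡n%2+HW[n/2] n@(suc n-1) = cong (n % 2 +_) (hwAux-stable {n-1} {n / 2} (n≤1+f⇒n/2≤f ≤-refl) ≤-refl)

  HW-2* : ∀ m → HW (2 * m) ≡ HW m
  HW-2* m = trans (HW≡n%2+HW[n/2] (2 * m)) (cong₂ _+_ ([2m]%2≡0 m) (cong HW ([2m]/2≡m m)))

  HW-1+2* : ∀ m → HW (1 + 2 * m) ≡ suc (HW m)
  HW-1+2* m = trans (HW≡n%2+HW[n/2] (1 + 2 * m)) (cong₂ _+_ ([1+2m]%2≡1 m) (cong HW ([1+2m]/2≡m m)))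

  oddFactorial : ℕ → ℕ
  oddFactorial zero    = 1
  oddFactorial (suc m) = (1 + 2 * m) * oddFactorial m

  ν₂[oddFactorial]≡0 : ∀ m → ν₂[ oddFactorial m ]≡ 0
  ν₂[oddFactorial]≡0 zero    = ν₂[2^e]≡e 0
  ν₂[oddFactorial]≡0 (suc m) = ν₂-* (ν₂[1+2k]≡0 m) (ν₂[oddFactorial]≡0 m)

  [2m]!≡2^m*m!*oddFactorial : ∀ m → (2 * m) ! ≡ 2 ^ m * m ! * oddFactorial m
  [2m]!≡2^m*m!*oddFactorial zero    = refl
  [2m]!≡2^m*m!*oddFactorial (suc m) = begin
    (2 * suc m) !
      ≡⟨ cong _! (*-suc 2 m) ⟩
    (2 + 2 * m) * ((1 + 2 * m) * (2 * m) !)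
      ≡⟨ cong (λ x → (2 + 2 * m) * ((1 + 2 * m) * x)) ([2m]!≡2^m*m!*oddFactorial m) ⟩
    (2 + 2 * m) * ((1 + 2 * m) * (2 ^ m * m ! * oddFactorial m))
      ≡⟨ regroup m (2 ^ m) (m !) (oddFactorial m) ⟩
    2 ^ suc m * suc m ! * oddFactorial (suc m)
      ∎
    where
    open ≡-Reasoning
    regroup : ∀ m p f o →
              (2 + 2 * m) * ((1 + 2 * m) * (p * f * o)) ≡ 2 * p * ((1 + m) * f) * ((1 + 2 * m) * o)
    regroup = solve-∀

  ν₂[2^e*n*oddFactorial[k]] : ∀ e {n f} k → ν₂[ n ]≡ f → ν₂[ 2 ^ e * n * oddFactorial k ]≡ e + f + 0
  ν₂[2^e*n*oddFactorial[k]] e {n} {f} k ν = ν₂-* (ν₂-* (ν₂[2^e]≡e e) ν) (ν₂[oddFactorial]≡0 k)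

  -- Legendre's formula ν₂(n!) = n − HW(n), stated without truncated subtraction.
  ν₂[n!*2^HW[n]]≡n : ∀ n → ν₂[ n ! * 2 ^ HW n ]≡ n
  ν₂[n!*2^HW[n]]≡n = binary-induction (λ n → ν₂[ n ! * 2 ^ HW n ]≡ n) (mkν₂ 0 refl) even-step odd-step
    where
    regroup : ∀ p f o h → p * f * o * h ≡ p * (f * h) * o
    regroup = solve-∀
    even-step : ∀ m → ν₂[ m ! * 2 ^ HW m ]≡ m → ν₂[ (2 * m) ! * 2 ^ HW (2 * m) ]≡ 2 * m
    even-step m ih = subst₂ ν₂[_]≡_ (sym split) (+-assoc m m 0) (ν₂[2^e*n*oddFactorial[k]] m m ih)
      where
      split : (2 * m) ! * 2 ^ HW (2 * m) ≡ 2 ^ m * (m ! * 2 ^ HW m) * oddFactorial m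
      split = trans (cong₂ (λ x h → x * 2 ^ h) ([2m]!≡2^m*m!*oddFactorial m) (HW-2* m))
                    (regroup (2 ^ m) (m !) (oddFactorial m) (2 ^ HW m))
    odd-step : ∀ m → ν₂[ m ! * 2 ^ HW m ]≡ m → ν₂[ (1 + 2 * m) ! * 2 ^ HW (1 + 2 * m) ]≡ 1 + 2 * m
    odd-step m ih =
      subst₂ ν₂[_]≡_ (sym split) (cong suc (+-assoc m m 0)) (ν₂[2^e*n*oddFactorial[k]] (suc m) (suc m) ih)
      where
      regroup′ : ∀ m p f o h → (1 + 2 * m) * (p * f * o) * (2 * h) ≡ 2 * p * (f * h) * ((1 + 2 * m) * o)
      regroup′ = solve-∀
      split : (1 + 2 * m) ! * 2 ^ HW (1 + 2 * m) ≡ 2 ^ suc m * (m ! * 2 ^ HW m) * oddFactorial (suc m)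
      split = trans (cong₂ (λ x h → (1 + 2 * m) * x * 2 ^ h) ([2m]!≡2^m*m!*oddFactorial m) (HW-1+2* m))
                    (regroup′ m (2 ^ m) (m !) (oddFactorial m) (2 ^ HW m))

  nCk*k!*[n∸k]!≡n! : ∀ {n k} → k ≤ n → (n C k) * (k ! * (n ∸ k) !) ≡ n !
  nCk*k!*[n∸k]!≡n! {n} {k} k≤n =
    trans (cong (_* (k ! * (n ∸ k) !)) (nCk≡n!/k![n-k]! k≤n)) (m/n*n≡m {{_}} (k![n∸k]!∣n! k≤n))

  [2x]Cx*x!*x!≡[2x]! : ∀ x → ((2 * x) C x) * (x ! * x !) ≡ (2 * x) !
  [2x]Cx*x!*x!≡[2x]! x = subst (λ y → ((2 * x) C x) * (x ! * y !) ≡ (2 * x) !) [2x]∸x≡x (nCk*k!*[n∸k]!≡n! (m≤n*m x 2))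
    where
    [2x]∸x≡x : 2 * x ∸ x ≡ x
    [2x]∸x≡x = trans (m+n∸m≡n x (x + 0)) (+-identityʳ x)

  [2x]Cx≢0 : ∀ x → (2 * x) C x ≢ 0
  [2x]Cx≢0 x c≡0 = ≢-nonZero⁻¹ ((2 * x) !) {{(2 * x) !≢0}}
    (trans (sym ([2x]Cx*x!*x!≡[2x]! x)) (cong (_* (x ! * x !)) c≡0))

  ν₂[2xCx]≡HW[x] : ∀ x → ν₂[ (2 * x) C x ]≡ HW x
  ν₂[2xCx]≡HW[x] x with ν₂-exists ((2 * x) C x) ([2x]Cx≢0 x)
  ... | e , ν = subst (ν₂[ c ]≡_) e≡h ν
    where
    c h F : ℕ
    c = (2 * x) C x
    h = HW x
    F = x ! * 2 ^ h
    c*F*F≡2^x*F*oddFactorial[x]*2^h : c * F * F ≡ 2 ^ x * F * oddFactorial x * 2 ^ h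
    c*F*F≡2^x*F*oddFactorial[x]*2^h = begin
      c * F * F
        ≡⟨ shuffle₁ c (x !) (2 ^ h) ⟩
      c * (x ! * x !) * 2 ^ h * 2 ^ h
        ≡⟨ cong (λ y → y * 2 ^ h * 2 ^ h) (trans ([2x]Cx*x!*x!≡[2x]! x) ([2m]!≡2^m*m!*oddFactorial x)) ⟩
      2 ^ x * x ! * oddFactorial x * 2 ^ h * 2 ^ h
        ≡⟨ shuffle₂ (2 ^ x) (x !) (oddFactorial x) (2 ^ h) ⟩
      2 ^ x * F * oddFactorial x * 2 ^ h
        ∎
      where
      open ≡-Reasoning
      shuffle₁ : ∀ c f p → c * (f * p) * (f * p) ≡ c * (f * f) * p * p
      shuffle₁ = solve-∀
      shuffle₂ : ∀ q f o p → q * f * o * p * p ≡ q * (f * p) * o * p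
      shuffle₂ = solve-∀
    e+x+x≡x+x+0+h : e + x + x ≡ x + x + 0 + h
    e+x+x≡x+x+0+h = ν₂-unique
      (ν₂-* (ν₂-* ν (ν₂[n!*2^HW[n]]≡n x)) (ν₂[n!*2^HW[n]]≡n x))
      (subst (ν₂[_]≡ x + x + 0 + h) (sym c*F*F≡2^x*F*oddFactorial[x]*2^h)
        (ν₂-* (ν₂[2^e*n*oddFactorial[k]] x x (ν₂[n!*2^HW[n]]≡n x)) (ν₂[2^e]≡e h)))
    e≡h : e ≡ h
    e≡h = +-cancelˡ-≡ (x + x) e h (trans (comm₁ e x) (trans e+x+x≡x+x+0+h (comm₂ x h)))
      where
      comm₁ : ∀ e x → x + x + e ≡ e + x + x
      comm₁ = solve-∀
      comm₂ : ∀ x h → x + x + 0 + h ≡ x + x + h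
      comm₂ = solve-∀

module BinomialDigits where

  open import Data.Nat
  open import Data.Nat.Properties
  open import Data.Nat.DivMod using (_/_; _%_; m<n⇒m/n≡0; m*n/n≡m; +-distrib-/-∣ʳ; [m+kn]%n≡m%n; m<n⇒m%n≡m)
  open import Data.Nat.Divisibility using (divides)
  open import Data.Nat.Combinatorics using (_C_; nCk≡nC[n∸k]; nCk+nC[k+1]≡[n+1]C[k+1])
  open import Data.Nat.Tactic.RingSolver using (solve-∀)
  open import Data.Fin.Base using (Fin; toℕ)
  open import Data.Product using (∃-syntax; _,_)
  open import Function.Base using (_∘_)
  open import Relation.Binary.PropositionalEquality
  open import Algebra.Properties.CommutativeSemigroup *-commutativeSemigroup using (x∙yz≈y∙xz)
  import Algebra.Definitions.RawSemiring +-*-rawSemiring as Semiring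
  import Algebra.Properties.Semiring.Sum +-*-semiring as Sum
  import Algebra.Properties.CommutativeSemiring.Binomial +-*-commutativeSemiring as Binomial

  horner : ℕ → (ℕ → ℕ) → ℕ → ℕ
  horner u f zero    = 0
  horner u f (suc n) = f 0 + u * horner u (f ∘ suc) n

  horner-split : ∀ u f m n → horner u f (m + n) ≡ horner u f m + u ^ m * horner u (λ i → f (m + i)) n
  horner-split u f zero    n = sym (+-identityʳ _)
  horner-split u f (suc m) n = begin
    f 0 + u * horner u (f ∘ suc) (m + n)           ≡⟨ cong (λ h → f 0 + u * h) (horner-split u (f ∘ suc) m n) ⟩
    f 0 + u * (L + u ^ m * H)                      ≡⟨ distrib (f 0) u L (u ^ m) H ⟩
    f 0 + u * L + u * u ^ m * H                    ∎
    where
    open ≡-Reasoning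
    L H : ℕ
    L = horner u (f ∘ suc) m
    H = horner u (λ i → f (suc m + i)) n
    distrib : ∀ a u l p h → a + u * (l + p * h) ≡ a + u * l + u * p * h
    distrib = solve-∀

  horner-< : ∀ s u f n → (∀ i → s * f i < u) → s * horner u f n < u ^ n
  horner-< s u f zero    _      = subst (_< 1) (sym (*-zeroʳ s)) z<s
  horner-< s u f (suc n) digit< = begin-strict
    s * (f 0 + u * H)          ≡⟨ distrib s (f 0) u H ⟩
    s * f 0 + u * (s * H)      <⟨ +-monoˡ-< (u * (s * H)) (digit< 0) ⟩
    u + u * (s * H)            ≡⟨ *-suc u (s * H) ⟨
    u * suc (s * H)            ≤⟨ *-monoʳ-≤ u (horner-< s u (f ∘ suc) n (digit< ∘ suc)) ⟩
    u * u ^ n                  ∎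
    where
    open ≤-Reasoning
    H : ℕ
    H = horner u (f ∘ suc) n
    distrib : ∀ s a u h → s * (a + u * h) ≡ s * a + u * (s * h)
    distrib = solve-∀

  horner≡∑ : ∀ u f n → horner u f n ≡ Sum.sum {n} (λ i → f (toℕ i) * u ^ toℕ i)
  horner≡∑ u f zero    = refl
  horner≡∑ u f (suc n) = cong₂ _+_ (sym (*-identityʳ (f 0))) (begin
    u * horner u (f ∘ suc) n                        ≡⟨ cong (u *_) (horner≡∑ u (f ∘ suc) n) ⟩
    u * Sum.sum {n} (λ i → g i * u ^ toℕ i)         ≡⟨ Sum.*-distribˡ-sum {n} u (λ i → g i * u ^ toℕ i) ⟩
    Sum.sum {n} (λ i → u * (g i * u ^ toℕ i))       ≡⟨ Sum.sum-cong-≗ {n} (λ i → x∙yz≈y∙xz u (g i) (u ^ toℕ i)) ⟩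
    Sum.sum {n} (λ i → g i * (u * u ^ toℕ i))       ∎)
    where
    open ≡-Reasoning
    g : Fin n → ℕ
    g i = f (suc (toℕ i))

  ^≡Semiring^ : ∀ m n → m ^ n ≡ m Semiring.^ n
  ^≡Semiring^ m zero    = refl
  ^≡Semiring^ m (suc n) = cong (m *_) (^≡Semiring^ m n)

  *≡Semiring× : ∀ m n → m * n ≡ m Semiring.× n
  *≡Semiring× zero    n = refl
  *≡Semiring× (suc m) n = cong (n +_) (*≡Semiring× m n)

  binomial-theorem : ∀ u n → (1 + u) ^ n ≡ horner u (n C_) (suc n)
  binomial-theorem u n = begin
    (1 + u) ^ n                                        ≡⟨ cong (_^ n) (+-comm 1 u) ⟩
    (u + 1) ^ n                                        ≡⟨ ^≡Semiring^ (u + 1) n ⟩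
    (u + 1) Semiring.^ n                               ≡⟨ Binomial.theorem n u 1 ⟩
    Binomial.binomialExpansion u 1 n                   ≡⟨ Sum.sum-cong-≗ term ⟨
    Sum.sum {suc n} (λ k → (n C toℕ k) * u ^ toℕ k)    ≡⟨ horner≡∑ u (n C_) (suc n) ⟨
    horner u (n C_) (suc n)                            ∎
    where
    open ≡-Reasoning
    term : ∀ k → (n C toℕ k) * u ^ toℕ k ≡ Binomial.binomialTerm u 1 n k
    term k = begin
      c * u ^ j                                     ≡⟨ cong (c *_) (*-identityʳ (u ^ j)) ⟨
      c * (u ^ j * 1)                               ≡⟨ cong (λ p → c * (u ^ j * p)) (^-zeroˡ (n ∸ j)) ⟨
      c * (u ^ j * 1 ^ (n ∸ j))                     ≡⟨ cong₂ (λ p q → c * (p * q)) (^≡Semiring^ u j)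
                                                                                     (^≡Semiring^ 1 (n ∸ j)) ⟩
      c * (u Semiring.^ j * 1 Semiring.^ (n ∸ j))   ≡⟨ *≡Semiring× c _ ⟩
      Binomial.binomialTerm u 1 n k                 ∎
      where
      j c : ℕ
      j = toℕ k
      c = n C j

  nCk≤2^n : ∀ n k → n C k ≤ 2 ^ n
  nCk≤2^n zero    zero    = ≤-refl
  nCk≤2^n zero    (suc k) = z≤n
  nCk≤2^n (suc n) zero    = m^n>0 2 (suc n)
  nCk≤2^n (suc n) (suc k) = subst (_≤ 2 ^ suc n) (nCk+nC[k+1]≡[n+1]C[k+1] n k)
    (+-mono-≤ (nCk≤2^n n k) (≤-trans (nCk≤2^n n (suc k)) (m≤m+n (2 ^ n) 0)))

  [d+v]^n≡v^n+s*d : ∀ d v n → ∃[ s ] (d + v) ^ n ≡ v ^ n + s * d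
  [d+v]^n≡v^n+s*d d v zero    = 0 , refl
  [d+v]^n≡v^n+s*d d v (suc n) with [d+v]^n≡v^n+s*d d v n
  ... | s , eq = v ^ n + s * (d + v) , trans (cong ((d + v) *_) eq) (expand d v (v ^ n) s)
    where
    expand : ∀ d v p s → (d + v) * (p + s * d) ≡ v * p + (p + s * (d + v)) * d
    expand = solve-∀

  [m+kn]/n≡k : ∀ {m n} k .{{_ : NonZero n}} → m < n → (m + k * n) / n ≡ k
  [m+kn]/n≡k {m} {n} k m<n = trans (+-distrib-/-∣ʳ m (divides k refl)) (cong₂ _+_ (m<n⇒m/n≡0 m<n) (m*n/n≡m k n))

  [m+kn]%n≡m : ∀ {m n} k .{{_ : NonZero n}} → m < n → (m + k * n) % n ≡ m
  [m+kn]%n≡m {m} {n} k m<n = trans ([m+kn]%n≡m%n m k n) (m<n⇒m%n≡m m<n)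

  quotient-unique : ∀ {n r q r′ q′} → r < n → r′ < n → r + q * n ≡ r′ + q′ * n → q ≡ q′
  quotient-unique {n} {q = q} {q′ = q′} r<n r′<n eq = begin
    q                  ≡⟨ [m+kn]/n≡k q r<n ⟨
    (_ + q * n) / n    ≡⟨ cong (_/ n) eq ⟩
    (_ + q′ * n) / n   ≡⟨ [m+kn]/n≡k q′ r′<n ⟩
    q′                 ∎
    where
    open ≡-Reasoning
    instance
      n≢0 : NonZero n
      n≢0 = >-nonZero (≤-<-trans z≤n r<n)

  dividendExponent : ℕ → ℕ → ℕ
  dividendExponent a b = (2 * a + 4) * ((2 + a) * a + (2 + b))

  divisorExponent : ℕ → ℕ
  divisorExponent a = (2 * a + 4) * (2 + a)

  module BinomialDigit {a b : ℕ} (b≤a : b ≤ a) where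

    m u P U N : ℕ
    m = a ∸ b
    u = 2 ^ (2 * a + 4)
    P = u ^ (2 + b)
    U = u ^ (2 + a)
    N = U ^ a * P

    instance
      u≢0 : NonZero u
      u≢0 = m^n≢0 2 (2 * a + 4)

    2^divisorExponent≡U : 2 ^ divisorExponent a ≡ U
    2^divisorExponent≡U = sym (^-*-assoc 2 (2 * a + 4) (2 + a))

    2^dividendExponent≡N : 2 ^ dividendExponent a b ≡ N
    2^dividendExponent≡N = begin
      2 ^ (k * ((2 + a) * a + (2 + b)))              ≡⟨ cong (2 ^_) (*-distribˡ-+ k ((2 + a) * a) (2 + b)) ⟩
      2 ^ (k * ((2 + a) * a) + k * (2 + b))          ≡⟨ ^-distribˡ-+-* 2 (k * ((2 + a) * a)) (k * (2 + b)) ⟩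
      2 ^ (k * ((2 + a) * a)) * 2 ^ (k * (2 + b))    ≡⟨ cong₂ _*_ (^-*-assoc 2 k ((2 + a) * a)) (^-*-assoc 2 k (2 + b)) ⟨
      u ^ ((2 + a) * a) * P                          ≡⟨ cong (_* P) (^-*-assoc u (2 + a) a) ⟨
      N                                              ∎
      where
      open ≡-Reasoning
      k : ℕ
      k = 2 * a + 4

    digit-bound : ∀ k → 2 * suc (a C k) ≤ u
    digit-bound k = begin
      2 * suc (a C k)   ≤⟨ *-monoʳ-≤ 2 (+-mono-≤ (m^n>0 2 a) (≤-trans (nCk≤2^n a k) (m≤m+n (2 ^ a) 0))) ⟩
      2 ^ (2 + a)       ≤⟨ ^-monoʳ-≤ 2 (subst (2 + a ≤_) (regroup a) (m≤m+n (2 + a) (a + 2))) ⟩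
      u                 ∎
      where
      open ≤-Reasoning
      regroup : ∀ a → 2 + a + (a + 2) ≡ 2 * a + 4
      regroup = solve-∀

    Low High High′ : ℕ
    Low   = horner u (a C_) m
    High  = horner u (λ i → a C (m + i)) (suc b)
    High′ = horner u (λ i → a C (m + suc i)) b

    [1+u]^a≡Low+u^m*High : (1 + u) ^ a ≡ Low + u ^ m * High
    [1+u]^a≡Low+u^m*High = begin
      (1 + u) ^ a                     ≡⟨ binomial-theorem u a ⟩
      horner u (a C_) (suc a)         ≡⟨ cong (horner u (a C_)) 1+a≡m+[1+b] ⟩
      horner u (a C_) (m + suc b)     ≡⟨ horner-split u (a C_) m (suc b) ⟩
      Low + u ^ m * High              ∎
      where
      open ≡-Reasoning
      1+a≡m+[1+b] : suc a ≡ m + suc b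
      1+a≡m+[1+b] = trans (cong suc (sym (m∸n+n≡m b≤a))) (sym (+-suc m b))

    U≡u^m*P : U ≡ u ^ m * P
    U≡u^m*P = trans (cong (u ^_) 2+a≡m+[2+b]) (^-distribˡ-+-* u m (2 + b))
      where
      2+a≡m+[2+b] : 2 + a ≡ m + (2 + b)
      2+a≡m+[2+b] = trans (cong (2 +_) (sym (m∸n+n≡m b≤a))) (shuffle m b)
        where
        shuffle : ∀ m b → 2 + (m + b) ≡ m + (2 + b)
        shuffle = solve-∀

    C<u : ∀ k → a C k < u
    C<u k = ≤-trans (m≤n*m (suc (a C k)) 2) (digit-bound k)

    2C<u : ∀ k → 2 * (a C k) < u
    2C<u k = <-≤-trans (*-monoʳ-< 2 (n<1+n (a C k))) (digit-bound k)

    2≤u : 2 ≤ u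
    2≤u = ≤-trans (m≤m*n 2 (suc (a C 0))) (digit-bound 0)

    Low<u^m : Low < u ^ m
    Low<u^m = subst (_< u ^ m) (*-identityˡ Low)
      (horner-< 1 u (a C_) m (λ k → subst (_< u) (sym (*-identityˡ (a C k))) (C<u k)))

    2*[1+High]≤u^[1+b] : 2 * suc High ≤ u * u ^ b
    2*[1+High]≤u^[1+b] = begin
      2 * suc (a C (m + 0) + u * High′)          ≡⟨ distrib (a C (m + 0)) u High′ ⟩
      2 * suc (a C (m + 0)) + u * (2 * High′)    ≤⟨ +-monoˡ-≤ (u * (2 * High′)) (digit-bound (m + 0)) ⟩
      u + u * (2 * High′)                        ≡⟨ *-suc u (2 * High′) ⟨
      u * suc (2 * High′)                        ≤⟨ *-monoʳ-≤ u (horner-< 2 u _ b (λ i → 2C<u (m + suc i))) ⟩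
      u * u ^ b                                  ∎
      where
      open ≤-Reasoning
      distrib : ∀ c u h → 2 * suc (c + u * h) ≡ 2 * suc c + u * (2 * h)
      distrib = solve-∀

    [1+High]*[1+u]<P : suc High * (1 + u) < P
    [1+High]*[1+u]<P = begin-strict
      suc High * (1 + u)              <⟨ m<m+n (suc High * (1 + u)) z<s ⟩
      suc High * (1 + u) + suc High   ≡⟨ regroup₁ High u ⟩
      suc High * (2 + u)              ≤⟨ *-monoʳ-≤ (suc High) (+-monoˡ-≤ u 2≤u) ⟩
      suc High * (u + u)              ≡⟨ regroup₂ High u ⟩
      u * (2 * suc High)              ≤⟨ *-monoʳ-≤ u 2*[1+High]≤u^[1+b] ⟩
      u * (u * u ^ b)                 ∎
      where
      open ≤-Reasoning
      regroup₁ : ∀ h u → suc h * (1 + u) + suc h ≡ suc h * (2 + u)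
      regroup₁ = solve-∀
      regroup₂ : ∀ h u → suc h * (u + u) ≡ u * (2 * suc h)
      regroup₂ = solve-∀

    r₀ : ℕ
    r₀ = Low * P + High * (1 + u)

    r₀+[1+u]<U : r₀ + (1 + u) < U
    r₀+[1+u]<U = begin-strict
      r₀ + (1 + u)                          ≡⟨ regroup Low P High u ⟩
      Low * P + suc High * (1 + u)          <⟨ +-monoʳ-< (Low * P) [1+High]*[1+u]<P ⟩
      Low * P + P                           ≡⟨ +-comm (Low * P) P ⟩
      suc Low * P                           ≤⟨ *-monoˡ-≤ P Low<u^m ⟩
      u ^ m * P                             ≡⟨ U≡u^m*P ⟨
      U                                     ∎
      where
      open ≤-Reasoning
      regroup : ∀ l p h u → l * p + h * (1 + u) + (1 + u) ≡ l * p + suc h * (1 + u)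
      regroup = solve-∀

    N≡r₀+[s*P+High]*d : ∀ {d} → U ≡ d + (1 + u) → ∃[ s ] N ≡ r₀ + (s * P + High) * d
    N≡r₀+[s*P+High]*d {d} U≡d+[1+u] =
      let s , [d+v]^a≡ = [d+v]^n≡v^n+s*d d (1 + u) a in s , (begin
      U ^ a * P
        ≡⟨ cong (λ x → x ^ a * P) U≡d+[1+u] ⟩
      (d + (1 + u)) ^ a * P
        ≡⟨ cong (_* P) (trans [d+v]^a≡ (cong (_+ s * d) [1+u]^a≡Low+u^m*High)) ⟩
      (Low + u ^ m * High + s * d) * P
        ≡⟨ regroup₁ Low (u ^ m) High s d P ⟩
      Low * P + High * (u ^ m * P) + s * d * P
        ≡⟨ cong (λ x → Low * P + High * x + s * d * P) (trans (sym U≡u^m*P) U≡d+[1+u]) ⟩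
      Low * P + High * (d + (1 + u)) + s * d * P
        ≡⟨ regroup₂ Low P High d u s ⟩
      r₀ + (s * P + High) * d
        ∎)
      where
      open ≡-Reasoning
      regroup₁ : ∀ l p h s d x → (l + p * h + s * d) * x ≡ l * x + h * (p * x) + s * d * x
      regroup₁ = solve-∀
      regroup₂ : ∀ l p h d u s → l * p + h * (d + (1 + u)) + s * d * p ≡ l * p + h * (1 + u) + (s * p + h) * d
      regroup₂ = solve-∀

    [s*P+High]%u≡aCb : ∀ s → (s * P + High) % u ≡ a C b
    [s*P+High]%u≡aCb s = begin
      (s * P + High) % u                                   ≡⟨ cong (_% u) (regroup s u (u ^ b) (a C (m + 0)) High′) ⟩
      (a C (m + 0) + (High′ + s * (u * u ^ b)) * u) % u    ≡⟨ [m+kn]%n≡m (High′ + s * (u * u ^ b)) (C<u (m + 0)) ⟩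
      a C (m + 0)                                          ≡⟨ cong (a C_) (+-identityʳ m) ⟩
      a C (a ∸ b)                                          ≡⟨ nCk≡nC[n∸k] b≤a ⟨
      a C b                                                ∎
      where
      open ≡-Reasoning
      regroup : ∀ s u p c h → s * (u * (u * p)) + (c + u * h) ≡ c + (h + s * (u * p)) * u
      regroup = solve-∀

    binomial-digit : ∀ {d q r} → U ≡ d + (1 + u) → N ≡ r + q * d → r < d → q % u ≡ a C b
    binomial-digit {d} {q} {r} U≡d+[1+u] N≡r+qd r<d =
      let s , N≡r₀+[s*P+High]d = N≡r₀+[s*P+High]*d U≡d+[1+u] in
      trans (cong (_% u) (quotient-unique r<d r₀<d (trans (sym N≡r+qd) N≡r₀+[s*P+High]d))) ([s*P+High]%u≡aCb s)
      where
      r₀<d : r₀ < d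
      r₀<d = +-cancelʳ-≤ (1 + u) (suc r₀) d (subst (suc (r₀ + (1 + u)) ≤_) U≡d+[1+u] r₀+[1+u]<U)

module SumsOfSquares where

  open import Data.Nat as ℕ using (ℕ; z≤n)
  open import Data.Nat.Properties using (m+n≡0⇒m≡0; m+n≡0⇒n≡0)
  open import Data.Integer using (ℤ; +_; -[1+_]; 0ℤ; 1ℤ; _+_; _-_; _*_; _≤_; +≤+)
  open import Data.Integer.Properties using (+-injective; pos-*; i*j≡0⇒i≡0∨j≡0; i-j≡0⇒i≡j; i≡j⇒i-j≡0; +-mono-≤)
  open import Data.Integer.Tactic.RingSolver using (solve-∀)
  open import Data.Product using (_×_; _,_)
  open import Data.Product.Function.NonDependent.Propositional using (_×-⇔_)
  open import Data.Sum using ([_,_]′)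
  open import Function.Base using (id)
  open import Function.Bundles using (_⇔_; mk⇔; Equivalence)
  open import Function.Properties.Equivalence using () renaming (refl to ⇔-refl; trans to ⇔-trans)
  open import Relation.Binary.PropositionalEquality
  open import Defs
  open BinomialDigits using (dividendExponent; divisorExponent)

  sq-nonNeg : ∀ i → 0ℤ ≤ sq i
  sq-nonNeg (+ n)    = subst (0ℤ ≤_) (pos-* n n) (+≤+ z≤n)
  sq-nonNeg -[1+ n ] = +≤+ z≤n

  sq≡0⇔ : ∀ i → sq i ≡ 0ℤ ⇔ i ≡ 0ℤ
  sq≡0⇔ i = mk⇔ (λ i*i≡0 → [ id , id ]′ (i*j≡0⇒i≡0∨j≡0 i i*i≡0)) (λ { refl → refl })

  nonNeg+nonNeg≡0⇔ : ∀ {i j} → 0ℤ ≤ i → 0ℤ ≤ j → i + j ≡ 0ℤ ⇔ (i ≡ 0ℤ × j ≡ 0ℤ)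
  nonNeg+nonNeg≡0⇔ (+≤+ {n = m} _) (+≤+ _) = mk⇔
    (λ m+n≡0 → cong (+_) (m+n≡0⇒m≡0 m (+-injective m+n≡0)) , cong (+_) (m+n≡0⇒n≡0 m (+-injective m+n≡0)))
    (λ { (refl , refl) → refl })

  i-j≡0⇔i≡j : ∀ {i j} → i - j ≡ 0ℤ ⇔ i ≡ j
  i-j≡0⇔i≡j {i} {j} = mk⇔ (i-j≡0⇒i≡j i j) i≡j⇒i-j≡0

  +m-i≡0⇔ : ∀ {m n i} → i ≡ + n → + m - i ≡ 0ℤ ⇔ m ≡ n
  +m-i≡0⇔ refl = ⇔-trans i-j≡0⇔i≡j (mk⇔ +-injective (cong (+_)))

  +m-i-j≡0⇔ : ∀ {m n} i j → i + j ≡ + n → + m - i - j ≡ 0ℤ ⇔ m ≡ n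
  +m-i-j≡0⇔ {m} i j i+j≡n = subst (λ k → k ≡ 0ℤ ⇔ _) (sym (assoc (+ m) i j)) (+m-i≡0⇔ i+j≡n)
    where
    assoc : ∀ m i j → m - i - j ≡ m - (i + j)
    assoc = solve-∀

  +m-i-j-k≡0⇔ : ∀ {m n} i j k → i + j + k ≡ + n → + m - i - j - k ≡ 0ℤ ⇔ m ≡ n
  +m-i-j-k≡0⇔ {m} i j k i+j+k≡n = subst (λ l → l ≡ 0ℤ ⇔ _) (sym (assoc (+ m) i j k)) (+m-i≡0⇔ i+j+k≡n)
    where
    assoc : ∀ m i j k → m - i - j - k ≡ m - (i + j + k)
    assoc = solve-∀

  +dividendExponent : ∀ a b → + dividendExponent a b ≡
    + 2 * + a * + a * + a + + 8 * + a * + a + + 2 * + a * + b + + 12 * + a + + 4 * + b + + 8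
  +dividendExponent a b = begin
    + ((2 ℕ.* a ℕ.+ 4) ℕ.* ((2 ℕ.+ a) ℕ.* a ℕ.+ (2 ℕ.+ b)))
      ≡⟨ pos-* (2 ℕ.* a ℕ.+ 4) _ ⟩
    + (2 ℕ.* a ℕ.+ 4) * + ((2 ℕ.+ a) ℕ.* a ℕ.+ (2 ℕ.+ b))
      ≡⟨ cong₂ _*_ (cong (_+ + 4) (pos-* 2 a)) (cong (_+ (+ 2 + + b)) (pos-* (2 ℕ.+ a) a)) ⟩
    (+ 2 * + a + + 4) * ((+ 2 + + a) * + a + (+ 2 + + b))
      ≡⟨ expand (+ a) (+ b) ⟩
    + 2 * + a * + a * + a + + 8 * + a * + a + + 2 * + a * + b + + 12 * + a + + 4 * + b + + 8
      ∎
    where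
    open ≡-Reasoning
    expand : ∀ a b → (+ 2 * a + + 4) * ((+ 2 + a) * a + (+ 2 + b)) ≡
             + 2 * a * a * a + + 8 * a * a + + 2 * a * b + + 12 * a + + 4 * b + + 8
    expand = solve-∀

  +divisorExponent : ∀ a → + divisorExponent a ≡ + 2 * + a * + a + + 8 * + a + + 8
  +divisorExponent a = begin
    + ((2 ℕ.* a ℕ.+ 4) ℕ.* (2 ℕ.+ a))   ≡⟨ pos-* (2 ℕ.* a ℕ.+ 4) (2 ℕ.+ a) ⟩
    + (2 ℕ.* a ℕ.+ 4) * (+ 2 + + a)     ≡⟨ cong (λ x → (x + + 4) * (+ 2 + + a)) (pos-* 2 a) ⟩
    (+ 2 * + a + + 4) * (+ 2 + + a)     ≡⟨ expand (+ a) ⟩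
    + 2 * + a * + a + + 8 * + a + + 8   ∎
    where
    open ≡-Reasoning
    expand : ∀ a → (+ 2 * a + + 4) * (+ 2 + a) ≡ + 2 * a * a + + 8 * a + + 8
    expand = solve-∀

  record _vanishes-iff_ (i : ℤ) (P : Set) : Set where
    field
      nonNeg : 0ℤ ≤ i
      ≡0⇔    : i ≡ 0ℤ ⇔ P

  open _vanishes-iff_

  sq-vanishes-iff : ∀ {i P} → i ≡ 0ℤ ⇔ P → sq i vanishes-iff P
  sq-vanishes-iff {i} i≡0⇔P = record { nonNeg = sq-nonNeg i ; ≡0⇔ = ⇔-trans (sq≡0⇔ i) i≡0⇔P }

  +-vanishes-iff : ∀ {i j P Q} → i vanishes-iff P → j vanishes-iff Q → (i + j) vanishes-iff (P × Q)
  +-vanishes-iff i⇔P j⇔Q = record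
    { nonNeg = +-mono-≤ (nonNeg i⇔P) (nonNeg j⇔Q)
    ; ≡0⇔    = ⇔-trans (nonNeg+nonNeg≡0⇔ (nonNeg i⇔P) (nonNeg j⇔Q)) (≡0⇔ i⇔P ×-⇔ ≡0⇔ j⇔Q)
    }

  vanishes-iff-⇔ : ∀ {i P Q} → i vanishes-iff P → P ⇔ Q → i vanishes-iff Q
  vanishes-iff-⇔ i⇔P P⇔Q = record { nonNeg = nonNeg i⇔P ; ≡0⇔ = ⇔-trans (≡0⇔ i⇔P) P⇔Q }

  E/-vanishes-iff : ∀ {n b q r s} →
    E/ (+ n) b (+ r) (+ s) (+ q) vanishes-iff (n ≡ (r ℕ.+ s ℕ.+ 1) ℕ.* q ℕ.+ r × + (r ℕ.+ s ℕ.+ 1) ≡ b)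
  E/-vanishes-iff {n} {b} {q} {r} {s} = record
    { nonNeg = +-mono-≤ (sq-nonNeg (+ n - b * + q - + r)) (sq-nonNeg (+ d - b))
    ; ≡0⇔    = mk⇔ to from
    }
    where
    d : ℕ
    d = r ℕ.+ s ℕ.+ 1
    quotient⇔ : + n - + d * + q - + r ≡ 0ℤ ⇔ n ≡ d ℕ.* q ℕ.+ r
    quotient⇔ = +m-i-j≡0⇔ (+ d * + q) (+ r) (cong (_+ + r) (sym (pos-* d q)))
    to : E/ (+ n) b (+ r) (+ s) (+ q) ≡ 0ℤ → n ≡ d ℕ.* q ℕ.+ r × + d ≡ b
    to E/≡0 =
      let quotient² , divisor² =
            Equivalence.to (nonNeg+nonNeg≡0⇔ (sq-nonNeg (+ n - b * + q - + r)) (sq-nonNeg (+ d - b))) E/≡0 in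
      substituted (i-j≡0⇒i≡j (+ d) b (Equivalence.to (sq≡0⇔ (+ d - b)) divisor²)) quotient²
      where
      substituted : ∀ {b} → + d ≡ b → sq (+ n - b * + q - + r) ≡ 0ℤ → n ≡ d ℕ.* q ℕ.+ r × + d ≡ b
      substituted refl quotient² = Equivalence.to (⇔-trans (sq≡0⇔ (+ n - + d * + q - + r)) quotient⇔) quotient² , refl
    from : n ≡ d ℕ.* q ℕ.+ r × + d ≡ b → E/ (+ n) b (+ r) (+ s) (+ q) ≡ 0ℤ
    from (n≡dq+r , refl) = cong₂ (λ i j → sq i + sq j) (Equivalence.from quotient⇔ n≡dq+r) (i≡j⇒i-j≡0 {+ d} refl)

  Emod-vanishes-iff : ∀ {n u q r s} →
    Emod (+ n) (+ u) (+ q) (+ s) (+ r) vanishes-iff (n ≡ u ℕ.* q ℕ.+ r × r ℕ.+ s ℕ.+ 1 ≡ u)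
  Emod-vanishes-iff {u = u} {q} {r} = +-vanishes-iff
    (sq-vanishes-iff (+m-i-j≡0⇔ (+ u * + q) (+ r) (cong (_+ + r) (sym (pos-* u q)))))
    (sq-vanishes-iff (+m-i≡0⇔ refl))

  EνEquations : ℕ → ℕ → ℕ → ℕ → ℕ → ℕ → Set
  EνEquations a z₁ z₂ z₃ z₄ e =
    (a ≡ 2 ℕ.^ ℕ.suc e ℕ.* z₁ ℕ.+ z₂ ℕ.+ 1 × z₂ ℕ.+ z₃ ℕ.+ 2 ≡ 2 ℕ.^ ℕ.suc e) × a ≡ 2 ℕ.^ e ℕ.* z₄

  Eν-vanishes-iff : ∀ a z₁ z₂ z₃ z₄ e → Eν a z₁ z₂ z₃ z₄ e vanishes-iff EνEquations a z₁ z₂ z₃ z₄ e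
  Eν-vanishes-iff a z₁ z₂ z₃ z₄ e = +-vanishes-iff
    (+-vanishes-iff
      (sq-vanishes-iff (+m-i-j-k≡0⇔ (pow2 (ℕ.suc e) * + z₁) (+ z₂) 1ℤ
                                     (cong (λ x → x + + z₂ + 1ℤ) (sym (pos-* (2 ℕ.^ ℕ.suc e) z₁)))))
      (sq-vanishes-iff (+m-i≡0⇔ refl)))
    (sq-vanishes-iff (+m-i≡0⇔ (sym (pos-* (2 ℕ.^ e) z₄))))

  +d≡+m-+k-1⇔ : ∀ {d m k} → + d ≡ + m - + k - 1ℤ ⇔ m ≡ d ℕ.+ (1 ℕ.+ k)
  +d≡+m-+k-1⇔ {d} {m} {k} = mk⇔
    (λ d≡ → +-injective (trans (cancel₁ (+ m) (+ k)) (cong (_+ (1ℤ + + k)) (sym d≡))))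
    (λ { refl → sym (cancel₂ (+ d) (+ k)) })
    where
    cancel₁ : ∀ m k → m ≡ m - k - 1ℤ + (1ℤ + k)
    cancel₁ = solve-∀
    cancel₂ : ∀ d k → d + (1ℤ + k) - k - 1ℤ ≡ d
    cancel₂ = solve-∀

  -- z₃ and z₄ are the quotient and remainder of 2^z₁ by d = z₄ + z₅ + 1 = 2^z₂ − u − 1,
  -- and c is the remainder of z₃ by u = 2^(2a+4).
  BEquations : ℕ → ℕ → ℕ → ℕ → ℕ → ℕ → ℕ → ℕ → ℕ → ℕ → Set
  BEquations a b z₁ z₂ z₃ z₄ z₅ z₆ z₇ c =
    ((z₁ ≡ dividendExponent a b × z₂ ≡ divisorExponent a)
     × (2 ℕ.^ z₁ ≡ (z₄ ℕ.+ z₅ ℕ.+ 1) ℕ.* z₃ ℕ.+ z₄ × 2 ℕ.^ z₂ ≡ z₄ ℕ.+ z₅ ℕ.+ 1 ℕ.+ (1 ℕ.+ u)))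
    × (z₃ ≡ u ℕ.* z₆ ℕ.+ c × c ℕ.+ z₇ ℕ.+ 1 ≡ u)
    where
    u : ℕ
    u = 2 ℕ.^ (2 ℕ.* a ℕ.+ 4)

  B-vanishes-iff : ∀ a b z₁ z₂ z₃ z₄ z₅ z₆ z₇ c →
    B a b z₁ z₂ z₃ z₄ z₅ z₆ z₇ c vanishes-iff BEquations a b z₁ z₂ z₃ z₄ z₅ z₆ z₇ c
  B-vanishes-iff a b _ _ _ _ _ _ _ _ = +-vanishes-iff
    (+-vanishes-iff
      (+-vanishes-iff (sq-vanishes-iff (+m-i≡0⇔ (sym (+dividendExponent a b))))
                      (sq-vanishes-iff (+m-i≡0⇔ (sym (+divisorExponent a)))))
      (vanishes-iff-⇔ E/-vanishes-iff (⇔-refl ×-⇔ +d≡+m-+k-1⇔)))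
    Emod-vanishes-iff

module Diophantine where

  open import Data.Nat
  open import Data.Nat.Properties
  open import Data.Nat.DivMod using (_/_; _%_; m≡m%n+[m/n]*n; m%n<n)
  open import Data.Nat.Combinatorics using (_C_)
  open import Data.Nat.Tactic.RingSolver using (solve-∀)
  open import Data.Integer using (0ℤ)
  open import Data.Product using (∃-syntax; _,_; proj₁; proj₂)
  open import Function.Bundles using (_⇔_; mk⇔; Equivalence)
  open import Relation.Binary.PropositionalEquality
  open import Relation.Nullary using (contradiction)
  open import Defs using (B; Eν)
  open TwoAdicValuation using (ν₂[_]≡_; mkν₂; evenOdd; even; odd)
  open BinomialDigits
  open SumsOfSquares using (_vanishes-iff_; BEquations; B-vanishes-iff; EνEquations; Eν-vanishes-iff)

  <⇔∃[s]m+s+1≡n : ∀ {m n} → m < n ⇔ (∃[ s ] m + s + 1 ≡ n)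
  <⇔∃[s]m+s+1≡n {m} {n} = mk⇔ to from
    where
    to : m < n → ∃[ s ] m + s + 1 ≡ n
    to m<n with m≤n⇒∃[o]m+o≡n m<n
    ... | s , 1+m+s≡n = s , trans (+-comm (m + s) 1) 1+m+s≡n
    from : ∃[ s ] m + s + 1 ≡ n → m < n
    from (s , m+s+1≡n) = subst (m <_) (trans (+-comm 1 (m + s)) m+s+1≡n) (s≤s (m≤m+n m s))

  BEquations⇒c≡aCb : ∀ {a b z₁ z₂ z₃ z₄ z₅ z₆ z₇ c} → b ≤ a → BEquations a b z₁ z₂ z₃ z₄ z₅ z₆ z₇ c → c ≡ a C b
  BEquations⇒c≡aCb {a} {b} {z₃ = z₃} {z₄} {z₅} {z₆} {z₇} {c} b≤a
    (((refl , refl) , (2^z₁≡dz₃+z₄ , 2^z₂≡d+[1+u])) , (z₃≡uz₆+c , c+z₇+1≡u)) = begin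
      c                  ≡⟨ [m+kn]%n≡m z₆ c<u ⟨
      (c + z₆ * u) % u   ≡⟨ cong (_% u) (trans (+-comm c (z₆ * u)) (trans (cong (_+ c) (*-comm z₆ u)) (sym z₃≡uz₆+c))) ⟩
      z₃ % u             ≡⟨ binomial-digit U≡d+[1+u] N≡z₄+z₃d z₄<d ⟩
      a C b              ∎
    where
    open ≡-Reasoning
    open BinomialDigit b≤a
    d : ℕ
    d = z₄ + z₅ + 1
    c<u : c < u
    c<u = Equivalence.from <⇔∃[s]m+s+1≡n (z₇ , c+z₇+1≡u)
    z₄<d : z₄ < d
    z₄<d = Equivalence.from <⇔∃[s]m+s+1≡n (z₅ , refl)
    U≡d+[1+u] : U ≡ d + (1 + u)
    U≡d+[1+u] = trans (sym 2^divisorExponent≡U) 2^z₂≡d+[1+u]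
    N≡z₄+z₃d : N ≡ z₄ + z₃ * d
    N≡z₄+z₃d = trans (sym 2^dividendExponent≡N)
                     (trans 2^z₁≡dz₃+z₄ (trans (+-comm (d * z₃) z₄) (cong (z₄ +_) (*-comm d z₃))))

  BEquations-solvable : ∀ {a b} → b ≤ a →
    ∃[ z₁ ] ∃[ z₂ ] ∃[ z₃ ] ∃[ z₄ ] ∃[ z₅ ] ∃[ z₆ ] ∃[ z₇ ] BEquations a b z₁ z₂ z₃ z₄ z₅ z₆ z₇ (a C b)
  BEquations-solvable {a} {b} b≤a =
    z₁ , z₂ , z₃ , z₄ , z₅ , z₆ , z₇ , ((refl , refl) , (2^z₁≡dz₃+z₄ , 2^z₂≡d+[1+u])) , (z₃≡uz₆+c , c+z₇+1≡u)
    where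
    open ≡-Reasoning
    open BinomialDigit b≤a
    1+u<U : 1 + u < U
    1+u<U = ≤-<-trans (m≤n+m (1 + u) r₀) r₀+[1+u]<U
    d : ℕ
    d = suc (proj₁ (Equivalence.to <⇔∃[s]m+s+1≡n 1+u<U))
    U≡d+[1+u] : U ≡ d + (1 + u)
    U≡d+[1+u] = trans (sym (proj₂ (Equivalence.to <⇔∃[s]m+s+1≡n 1+u<U))) (regroup u (pred d))
      where
      regroup : ∀ u o → 1 + u + o + 1 ≡ suc o + (1 + u)
      regroup = solve-∀
    z₁ z₂ z₃ z₄ z₅ z₆ z₇ : ℕ
    z₁ = dividendExponent a b
    z₂ = divisorExponent a
    z₃ = N / d
    z₄ = N % d
    z₅ = proj₁ (Equivalence.to <⇔∃[s]m+s+1≡n (m%n<n N d))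
    z₆ = z₃ / u
    z₇ = proj₁ (Equivalence.to <⇔∃[s]m+s+1≡n (C<u b))
    z₄+z₅+1≡d : z₄ + z₅ + 1 ≡ d
    z₄+z₅+1≡d = proj₂ (Equivalence.to <⇔∃[s]m+s+1≡n (m%n<n N d))
    c+z₇+1≡u : a C b + z₇ + 1 ≡ u
    c+z₇+1≡u = proj₂ (Equivalence.to <⇔∃[s]m+s+1≡n (C<u b))
    2^z₁≡dz₃+z₄ : 2 ^ z₁ ≡ (z₄ + z₅ + 1) * z₃ + z₄
    2^z₁≡dz₃+z₄ = begin
      2 ^ z₁                    ≡⟨ 2^dividendExponent≡N ⟩
      N                         ≡⟨ m≡m%n+[m/n]*n N d ⟩
      z₄ + z₃ * d               ≡⟨ +-comm z₄ (z₃ * d) ⟩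
      z₃ * d + z₄               ≡⟨ cong (λ x → z₃ * x + z₄) z₄+z₅+1≡d ⟨
      z₃ * (z₄ + z₅ + 1) + z₄   ≡⟨ cong (_+ z₄) (*-comm z₃ (z₄ + z₅ + 1)) ⟩
      (z₄ + z₅ + 1) * z₃ + z₄   ∎
    2^z₂≡d+[1+u] : 2 ^ z₂ ≡ z₄ + z₅ + 1 + (1 + u)
    2^z₂≡d+[1+u] = trans 2^divisorExponent≡U (trans U≡d+[1+u] (cong (_+ (1 + u)) (sym z₄+z₅+1≡d)))
    z₃≡uz₆+c : z₃ ≡ u * z₆ + a C b
    z₃≡uz₆+c = begin
      z₃                  ≡⟨ m≡m%n+[m/n]*n z₃ u ⟩
      z₃ % u + z₆ * u     ≡⟨ cong₂ _+_ (binomial-digit U≡d+[1+u] (m≡m%n+[m/n]*n N d) (m%n<n N d)) (*-comm z₆ u) ⟩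
      a C b + u * z₆      ≡⟨ +-comm (a C b) (u * z₆) ⟩
      u * z₆ + a C b      ∎

  B-diophantine : ∀ {a b} → b ≤ a → ∀ c →
    (∃[ z₁ ] ∃[ z₂ ] ∃[ z₃ ] ∃[ z₄ ] ∃[ z₅ ] ∃[ z₆ ] ∃[ z₇ ] B a b z₁ z₂ z₃ z₄ z₅ z₆ z₇ c ≡ 0ℤ) ⇔ c ≡ a C b
  B-diophantine {a} {b} b≤a c = mk⇔
    (λ (z₁ , z₂ , z₃ , z₄ , z₅ , z₆ , z₇ , B≡0) →
       BEquations⇒c≡aCb {z₁ = z₁} {z₂} {z₃} {z₄} {z₅} {z₆} {z₇} b≤a
         (Equivalence.to (≡0⇔ (B-vanishes-iff a b z₁ z₂ z₃ z₄ z₅ z₆ z₇ c)) B≡0))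
    (λ { refl → let z₁ , z₂ , z₃ , z₄ , z₅ , z₆ , z₇ , equations = BEquations-solvable b≤a in
       z₁ , z₂ , z₃ , z₄ , z₅ , z₆ , z₇ ,
       Equivalence.from (≡0⇔ (B-vanishes-iff a b z₁ z₂ z₃ z₄ z₅ z₆ z₇ c)) equations })
    where open _vanishes-iff_

  EνEquations⇒ν₂ : ∀ {a z₁ z₂ z₃ z₄ e} → EνEquations a z₁ z₂ z₃ z₄ e → ν₂[ a ]≡ e
  EνEquations⇒ν₂ {a} {z₁} {z₂} {z₃} {z₄} {e} ((a≡ , z₂+z₃+2≡) , a≡2^e*z₄) with evenOdd z₄
  ... | odd k  = mkν₂ k a≡2^e*z₄
  ... | even j = contradiction (trans (sym a%2^[1+e]≡0) a%2^[1+e]≡1+z₂) λ ()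
    where
    instance
      2^[1+e]≢0 : NonZero (2 ^ suc e)
      2^[1+e]≢0 = m^n≢0 2 (suc e)
    1+z₂<2^[1+e] : suc z₂ < 2 ^ suc e
    1+z₂<2^[1+e] = Equivalence.from <⇔∃[s]m+s+1≡n (z₃ , trans (regroup z₂ z₃) z₂+z₃+2≡)
      where
      regroup : ∀ x y → suc x + y + 1 ≡ x + y + 2
      regroup = solve-∀
    a%2^[1+e]≡0 : a % 2 ^ suc e ≡ 0
    a%2^[1+e]≡0 = trans (cong (_% 2 ^ suc e) (trans a≡2^e*z₄ (regroup (2 ^ e) j))) ([m+kn]%n≡m j (m^n>0 2 (suc e)))
      where
      regroup : ∀ p j → p * (2 * j) ≡ 0 + j * (2 * p)
      regroup = solve-∀
    a%2^[1+e]≡1+z₂ : a % 2 ^ suc e ≡ suc z₂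
    a%2^[1+e]≡1+z₂ = trans (cong (_% 2 ^ suc e) (trans a≡ (regroup (2 ^ suc e) z₁ z₂))) ([m+kn]%n≡m z₁ 1+z₂<2^[1+e])
      where
      regroup : ∀ p z₁ z₂ → p * z₁ + z₂ + 1 ≡ suc z₂ + z₁ * p
      regroup = solve-∀

  ν₂⇒EνEquations : ∀ {a e} → ν₂[ a ]≡ e → ∃[ z₁ ] ∃[ z₂ ] ∃[ z₃ ] ∃[ z₄ ] EνEquations a z₁ z₂ z₃ z₄ e
  ν₂⇒EνEquations {a} {e} (mkν₂ k a≡2^e*[1+2k]) =
    k , p , p , 1 + 2 * k , (a≡ , p+p+2≡2^[1+e]) , a≡2^e*[1+2k]
    where
    open ≡-Reasoning
    instance
      2^e≢0 : NonZero (2 ^ e)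
      2^e≢0 = m^n≢0 2 e
    p : ℕ
    p = pred (2 ^ e)
    a≡ : a ≡ 2 ^ suc e * k + p + 1
    a≡ = begin
      a                            ≡⟨ a≡2^e*[1+2k] ⟩
      2 ^ e * (1 + 2 * k)          ≡⟨ cong (_* (1 + 2 * k)) (suc-pred (2 ^ e)) ⟨
      suc p * (1 + 2 * k)          ≡⟨ regroup p k ⟩
      2 * suc p * k + p + 1        ≡⟨ cong (λ x → 2 * x * k + p + 1) (suc-pred (2 ^ e)) ⟩
      2 ^ suc e * k + p + 1        ∎
      where
      regroup : ∀ p k → suc p * (1 + 2 * k) ≡ 2 * suc p * k + p + 1
      regroup = solve-∀
    p+p+2≡2^[1+e] : p + p + 2 ≡ 2 ^ suc e
    p+p+2≡2^[1+e] = trans (regroup p) (cong (2 *_) (suc-pred (2 ^ e)))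
      where
      regroup : ∀ p → p + p + 2 ≡ 2 * suc p
      regroup = solve-∀

  Eν-diophantine : ∀ a e → (∃[ z₁ ] ∃[ z₂ ] ∃[ z₃ ] ∃[ z₄ ] Eν a z₁ z₂ z₃ z₄ e ≡ 0ℤ) ⇔ ν₂[ a ]≡ e
  Eν-diophantine a e = mk⇔
    (λ (z₁ , z₂ , z₃ , z₄ , Eν≡0) →
       EνEquations⇒ν₂ {z₁ = z₁} {z₂} {z₃} {z₄} (Equivalence.to (≡0⇔ (Eν-vanishes-iff a z₁ z₂ z₃ z₄ e)) Eν≡0))
    (λ ν → let z₁ , z₂ , z₃ , z₄ , equations = ν₂⇒EνEquations ν in
       z₁ , z₂ , z₃ , z₄ , Equivalence.from (≡0⇔ (Eν-vanishes-iff a z₁ z₂ z₃ z₄ e)) equations)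
    where open _vanishes-iff_

open import Data.Nat.Combinatorics using (_C_)
open import Data.Nat as ℕ using (_*_)
open import Data.Nat.Properties using (m≤n*m)
open import Data.Product using (_,_)
open import Function.Bundles using (mk⇔; Equivalence)
open import Relation.Binary.PropositionalEquality using (refl; sym; subst; cong₂)
open TwoAdicValuation using (ν₂[_]≡_; ν₂-unique; ν₂[2xCx]≡HW[x])
open SumsOfSquares using (B-vanishes-iff; Eν-vanishes-iff; nonNeg+nonNeg≡0⇔; _vanishes-iff_)
open Diophantine using (B-diophantine; Eν-diophantine)

open import Defs
open import Data.Nat using (ℕ)
open import Data.Integer using (ℤ; _+_; +_)
open import Data.Product using (Σ; _×_)
open import Function.Bundles using (_⇔_)
open import Relation.Binary.PropositionalEquality using (_≡_)

mainTheorem12 : (x₁ x₂ : ℕ) →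
    (x₂ ≡ HW x₁) ⇔
    (Σ ℕ λ y₁ → Σ ℕ λ y₂ → Σ ℕ λ y₃ → Σ ℕ λ y₄ → Σ ℕ λ y₅ → Σ ℕ λ y₆ →
    Σ ℕ λ y₇ → Σ ℕ λ y₈ → Σ ℕ λ y₉ → Σ ℕ λ y₁₀ → Σ ℕ λ y₁₁ → Σ ℕ λ y₁₂ →
    B (2 Data.Nat.* x₁) x₁ y₂ y₃ y₄ y₅ y₆ y₇ y₈ y₁
    + Eν y₁ y₉ y₁₀ y₁₁ y₁₂ x₂ ≡ + 0)
mainTheorem12 x₁ x₂ = mk⇔
  (λ { refl →
    let y₂ , y₃ , y₄ , y₅ , y₆ , y₇ , y₈ , B≡0 = Equivalence.from (B-diophantine x₁≤2x₁ ((2 * x₁) C x₁)) refl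
        y₉ , y₁₀ , y₁₁ , y₁₂ , Eν≡0 = Equivalence.from (Eν-diophantine ((2 * x₁) C x₁) x₂) (ν₂[2xCx]≡HW[x] x₁)
    in (2 * x₁) C x₁ , y₂ , y₃ , y₄ , y₅ , y₆ , y₇ , y₈ , y₉ , y₁₀ , y₁₁ , y₁₂ , cong₂ _+_ B≡0 Eν≡0 })
  (λ (y₁ , y₂ , y₃ , y₄ , y₅ , y₆ , y₇ , y₈ , y₉ , y₁₀ , y₁₁ , y₁₂ , B+Eν≡0) →
    let B≡0 , Eν≡0 = Equivalence.to (nonNeg+nonNeg≡0⇔
                        (nonNeg (B-vanishes-iff (2 * x₁) x₁ y₂ y₃ y₄ y₅ y₆ y₇ y₈ y₁))
                        (nonNeg (Eν-vanishes-iff y₁ y₉ y₁₀ y₁₁ y₁₂ x₂))) B+Eν≡0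
        y₁≡2x₁Cx₁ = Equivalence.to (B-diophantine x₁≤2x₁ y₁) (y₂ , y₃ , y₄ , y₅ , y₆ , y₇ , y₈ , B≡0)
    in ν₂-unique (Equivalence.to (Eν-diophantine y₁ x₂) (y₉ , y₁₀ , y₁₁ , y₁₂ , Eν≡0))
                 (subst (ν₂[_]≡ HW x₁) (sym y₁≡2x₁Cx₁) (ν₂[2xCx]≡HW[x] x₁)))
  where
  open _vanishes-iff_
  x₁≤2x₁ : x₁ ℕ.≤ 2 * x₁
  x₁≤2x₁ = m≤n*m x₁ 2
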